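{- Let $\ell,m,n\ge1$ and let $D$ be an $(\ell,m)$-Dyck path of size $n$ with area partition $\mu(D)$. Let $p(D)=\prod_{e=\{i<j\}\in G(D)}(x_i-x_j)$ (edges with multiplicity), and let $\phi^{(\ell,m)}:\mathbb{C}[x_1,\dots,x_{n+1}]\to W_n^{(\ell,m)}$ be the linear map that sets $x_{n+1}=0$ and then sends every monomial that is not sub-$(\ell,m)$-staircase to $0$ while fixing sub-$(\ell,m)$-staircase monomials. Then \[ \phi^{(\ell,m)}(p(D))=x^{\mu(D)}+(\text{a linear combination of monomials whose exponent partitions are}\prec\mu(D)). \]
   Context: An $(\ell,m)$-Dyck path of size $n$ is a lattice path with unit steps $(0,1)$ and $(1,0)$ from $(-\ell+1,0)$ to $(mn,n)$ staying weakly above $y=x/m$. Its area partition $\mu(D)$ is the partition with $n$ parts whose Ferrers diagram is the set of unit boxes of $[-\ell+1,mn]\times[0,n]$ lying to the upper left of $D$. $G(D)$ is the sub-multigraph of $K^{(\ell,m)}_{n+1}$ (the multigraph on $[n+1]$ with $m$ edges between $i<j\le n$ and $\ell$ edges between $i\le n$ and $n+1$) obtained as follows: the boxes in the $i$-th row from the top are labeled, from left to right, by $\ell$ copies of the edge $\{i,n+1\}$ (only $\ell-1$ copies if $i=n$), then $m$ copies each of $\{i,n\},\{i,n-1\},\dots,\{i,i+2\}$, then $m-1$ copies of $\{i,i+1\}$; $G(D)$ consists of the labels of the boxes in the Ferrers diagram of $\mu(D)$. A partition $\lambda$ with $n$ parts is sub-$(\ell,m)$-staircase if $\lambda_i\le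 \ell-1+m(n-i)$ for all $i$; a monomial is sub-$(\ell,m)$-staircase if it equals $x_{w(1)}^{\lambda_1}\cdots x_{w(n)}^{\lambda_n}$ for some $w\in S_n$ and some sub-$(\ell,m)$-staircase $\lambda$; $W_n^{(\ell,m)}$ is their span. $x^\lambda=x_1^{\lambda_1}\cdots x_n^{\lambda_n}$. The exponent partition of a monomial in $x_1,\dots,x_n$ is the decreasing rearrangement of its exponent vector. Grevlex: $\lambda\prec\mu$ if $|\lambda|<|\mu|$, or $|\lambda|=|\mu|$ and the last nonzero entry of $\lambda-\mu$ is positive. -}

module Defs where

open import Data.Nat as ℕ using (ℕ; zero; suc; _+_; _*_; _∸_; _≤_; _<_; _≤ᵇ_; _≡ᵇ_)
open import Data.Nat.Properties using (≤-decTotalOrder)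
open import Data.Integer as ℤ using (ℤ; 0ℤ; 1ℤ; -1ℤ)
open import Data.Bool using (Bool; true; false; if_then_else_; _∧_)
open import Data.List as L using (List; []; _∷_; _++_; replicate; reverse; upTo; take; concat; concatMap; zipWith; foldr; map; length)
open import Data.Nat.ListAction using (sum)
open import Data.Vec as V using (Vec; tabulate; toList; _∷ʳ_)
open import Data.Vec.Properties using (≡-dec)
open import Data.Fin using (Fin; toℕ)
open import Data.Product using (_×_; _,_)
open import Data.Sum using (_⊎_)
open import Data.Empty using (⊥)
open import Relation.Nullary using (yes; no)
open import Relation.Binary.PropositionalEquality using (_≡_)
open import Data.List.Sort.InsertionSort ≤-decTotalOrder using (sort)

-- We use the shifted
-- x-coordinate x' = x + ℓ - 1, so the path runs from (0,0) to
-- (m n + ℓ - 1, n) and "weakly above y = x/m" reads  x' ≤ m y + ℓ - 1.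

data Step : Set where
  N E : Step

DyckFrom : (ℓ m n x y : ℕ) → List Step → Set
DyckFrom ℓ m n x y []       = (x ≡ m * n + (ℓ ∸ 1)) × (y ≡ n)
DyckFrom ℓ m n x y (N ∷ s) = DyckFrom ℓ m n x (suc y) s
DyckFrom ℓ m n x y (E ∷ s) = (suc x ≤ m * y + (ℓ ∸ 1)) × DyckFrom ℓ m n (suc x) y s

-- (ℓ,m)-Dyck path of size n: from (-ℓ+1,0) (shifted: (0,0)) to (mn,n).
IsDyck : (ℓ m n : ℕ) → List Step → Set
IsDyck ℓ m n D = DyckFrom ℓ m n 0 0 D

northXs : ℕ → List Step → List ℕ
northXs x []       = []
northXs x (N ∷ s) = x ∷ northXs x s
northXs x (E ∷ s) = northXs (suc x) s

-- area partition μ(D) = (μ₁ , … , μₙ), μᵢ = number of boxes of row i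
-- (from the top) lying to the left of D.
areaPartition : List Step → List ℕ
areaPartition D = reverse (northXs 0 D)

-- The graph G(D): labels of row i (1 ≤ i ≤ n, from the top), as pairs
-- (i , j) with i < j meaning the edge {i , j}.

rowLabels : (ℓ m n i : ℕ) → List (ℕ × ℕ)
rowLabels ℓ m n i with i ≡ᵇ n
... | true  = replicate (ℓ ∸ 1) (i , suc n)
... | false = replicate ℓ (i , suc n)
              ++ concatMap (λ j → replicate m (i , j))
                           (reverse (map (λ k → i + 2 + k) (upTo (n ∸ (i + 1)))))
              ++ replicate (m ∸ 1) (i , suc i)

G : (ℓ m n : ℕ) → List Step → List (ℕ × ℕ)
G ℓ m n D = concat (zipWith (λ i μi → take μi (rowLabels ℓ m n i))
                            (map suc (upTo n)) (areaPartition D))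

-- Polynomials in x₁ … x_k with integer coefficients, as formal sums of
-- terms (coefficient , exponent vector); x_i sits at position i - 1.

Poly : ℕ → Set
Poly k = List (ℤ × Vec ℕ k)

one : ∀ {k} → Poly k
one = (1ℤ , V.replicate _ 0) ∷ []

unitExp : (k i : ℕ) → Vec ℕ k
unitExp k i = tabulate (λ (r : Fin k) → if suc (toℕ r) ≡ᵇ i then 1 else 0)

diffPoly : (k i j : ℕ) → Poly k
diffPoly k i j = (1ℤ , unitExp k i) ∷ (-1ℤ , unitExp k j) ∷ []

mulPoly : ∀ {k} → Poly k → Poly k → Poly k
mulPoly P Q = concatMap (λ { (a , α) → map (λ { (b , β) → (a ℤ.* b , V.zipWith _+_ α β) }) Q }) P

coeff : ∀ {k} → Poly k → Vec ℕ k → ℤ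
coeff []             α = 0ℤ
coeff ((a , β) ∷ P) α with ≡-dec ℕ._≟_ β α
... | yes _ = a ℤ.+ coeff P α
... | no  _ = coeff P α

pD : (ℓ m n : ℕ) → List Step → Poly (suc n)
pD ℓ m n D = foldr (λ { (i , j) acc → mulPoly (diffPoly (suc n) i j) acc }) one (G ℓ m n D)

expPartition : ∀ {n} → Vec ℕ n → List ℕ
expPartition α = reverse (sort (toList α))

subStaircaseᵇ : (ℓ m n : ℕ) → List ℕ → Bool
subStaircaseᵇ ℓ m n λs =
  foldr _∧_ true (zipWith (λ i λi → λi ≤ᵇ (ℓ ∸ 1) + m * (n ∸ i)) (map suc (upTo n)) λs)

-- a monomial x^α in x₁…xₙ is sub-(ℓ,m)-staircase iff its exponent
-- partition (the only partition it can be a rearrangement of) is.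
subStaircaseMonᵇ : (ℓ m n : ℕ) → Vec ℕ n → Bool
subStaircaseMonᵇ ℓ m n α = subStaircaseᵇ ℓ m n (expPartition α)

φ : (ℓ m n : ℕ) → (Vec ℕ (suc n) → ℤ) → (Vec ℕ n → ℤ)
φ ℓ m n c α = if subStaircaseMonᵇ ℓ m n α then c (α ∷ʳ 0) else 0ℤ

FirstDiffGreater : List ℕ → List ℕ → Set
FirstDiffGreater []       _        = ⊥
FirstDiffGreater (x ∷ xs) []       = ⊥
FirstDiffGreater (x ∷ xs) (y ∷ ys) = (x ≡ y × FirstDiffGreater xs ys) ⊎ (y < x)

-- the last nonzero entry of λ - μ is positive
LastDiffPositive : List ℕ → List ℕ → Set
LastDiffPositive λs μs = FirstDiffGreater (reverse λs) (reverse μs)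

_≺_ : List ℕ → List ℕ → Set
λs ≺ μs = (sum λs < sum μs) ⊎ ((sum λs ≡ sum μs) × LastDiffPositive λs μs)

-- The product p(D) expands as a sum over picks: for each edge {i < j} of G(D) one takes x_i or
-- -x_j.  Row i of G(D) contributes exactly μ_i edges with smaller endpoint i, so picking x_i
-- everywhere gives x^μ(D) with coefficient 1.  Any other pick that survives x_{n+1} = 0 has a
-- largest right endpoint j ≤ n.  Its exponents agree with μ above j and exceed μ_j at j.  At a
-- vertex k ≤ j the exponent is at least μ_k ≥ μ_j, unless an edge from k was picked right; but
-- then the ℓ + m (n - j) edges from k that jump past j come before it in row k, all of them are
-- picked left, and the exponent of x_k exceeds the staircase bound ℓ - 1 + m (n - j) ≥ μ_j.  So
-- the exponent multiset has the same multiplicities as μ below μ_j and fewer copies of μ_j; with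
-- equal degree, this makes it grevlex-smaller.

module Submission where

open import Defs
open import Data.Nat using (ℕ; _≤_)
open import Data.Integer using (ℤ; 0ℤ; 1ℤ)
open import Data.List using (List)
open import Data.Vec using (Vec; toList)
open import Data.Product using (Σ; _×_)
open import Relation.Binary.PropositionalEquality using (_≡_; _≢_)

open import Data.Nat using (zero; suc; _+_; _*_; _∸_; _<_; _≤ᵇ_; _≡ᵇ_; _<ᵇ_; z≤n; s≤s; _⊔_; _⊓_)
open import Data.Nat.ListAction using (sum)
open import Data.Nat.ListAction.Properties using (sum-++; sum-↭)
open import Data.Nat.Properties
open import Algebra.Properties.CommutativeSemigroup +-commutativeSemigroup using (interchange)
open import Data.Nat.Tactic.RingSolver using (solve-∀)
open import Data.Bool using (Bool; true; false; if_then_else_; _∧_)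
open import Data.Bool.Properties using (T-≡; ∧-zeroʳ) renaming (_≟_ to _≟ᴮ_)
open import Data.Empty using (⊥; ⊥-elim)
open import Data.Fin as Fin using (toℕ)
import Data.Integer as ℤ
import Data.Integer.Properties as ℤ
open import Data.List
  using ([]; _∷_; _++_; _∷ʳ_; map; length; reverse; take; concat; concatMap; replicate; zipWith; foldr; upTo; applyUpTo)
open import Data.List.Properties
  using ( ∷-injective; ∷ʳ-injective; ++-assoc; ++-identityʳ; map-++; map-∘; map-cong; map-cong-local; map-applyUpTo
        ; concatMap-++; length-++; length-map; length-replicate; length-reverse; length-take
        ; reverse-++; reverse-involutive; unfold-reverse )
open import Data.List.Membership.Propositional using (_∈_; find; lose)
open import Data.List.Membership.Propositional.Properties using (∈-map⁺; ∈-map⁻; ∈-++⁻)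
open import Data.List.Relation.Binary.Permutation.Propositional using (_↭_; ↭-trans; ↭-sym; ↭⇒↭ₛ)
import Data.List.Relation.Binary.Permutation.Propositional.Properties as ↭
open import Data.List.Relation.Binary.Pointwise using (Pointwise-≡⇒≡)
open import Data.List.Relation.Unary.All using (All; []; _∷_)
import Data.List.Relation.Unary.All as All
import Data.List.Relation.Unary.All.Properties as All
open import Data.List.Relation.Unary.Any using (here; there; any?)
import Data.List.Relation.Unary.Any.Properties as Any
open import Data.List.Relation.Unary.Linked using (Linked; []; [-]; _∷_)
import Data.List.Relation.Unary.Linked as Linked
open import Data.List.Relation.Unary.Linked.Properties using (Linked⇒All)
open import Data.List.Sort.InsertionSort ≤-decTotalOrder using (sort)
import Data.List.Sort.InsertionSort.Properties ≤-decTotalOrder as Sort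
import Data.List.Relation.Unary.Sorted.TotalOrder.Properties as Sorted
open import Data.Product using (_,_; proj₁; proj₂; ∃-syntax; map₁)
open import Data.Sum using (_⊎_; inj₁; inj₂)
open import Data.Unit using (⊤)
import Data.Vec as Vec
import Data.Vec.Properties as Vec
open import Function using (_∘_; Equivalence)
open import Relation.Binary.Definitions using (tri<; tri≈; tri>)
open import Relation.Binary.PropositionalEquality using (_≗_; refl; sym; trans; cong; cong₂; subst; subst₂; module ≡-Reasoning)
open import Relation.Nullary using (¬_; yes; no)
open import Relation.Nullary.Decidable using (_×-dec_)

private variable
  A B : Set

sum-map-+ : (f g : A → ℕ) (xs : List A) →
            sum (map (λ x → f x + g x) xs) ≡ sum (map f xs) + sum (map g xs)
sum-map-+ f g []       = refl
sum-map-+ f g (x ∷ xs) = trans (cong (f x + g x +_) (sum-map-+ f g xs))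
                               (interchange (f x) (g x) (sum (map f xs)) (sum (map g xs)))

sum-map-∷ʳ : (f : A → ℕ) (xs : List A) (x : A) → sum (map f (xs ∷ʳ x)) ≡ sum (map f xs) + f x
sum-map-∷ʳ f xs x = begin
  sum (map f (xs ∷ʳ x))        ≡⟨ cong sum (map-++ f xs (x ∷ [])) ⟩
  sum (map f xs ++ f x ∷ [])   ≡⟨ sum-++ (map f xs) (f x ∷ []) ⟩
  sum (map f xs) + (f x + 0)   ≡⟨ cong (sum (map f xs) +_) (+-identityʳ (f x)) ⟩
  sum (map f xs) + f x         ∎
  where open ≡-Reasoning

sum-map-swap : (f : A → B → ℕ) (xs : List A) (ys : List B) →
               sum (map (λ x → sum (map (f x) ys)) xs) ≡ sum (map (λ y → sum (map (λ x → f x y) xs)) ys)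
sum-map-swap f []       ys = sym (sum-map-zero ys)
  where
    sum-map-zero : (ys : List B) → sum (map (λ _ → 0) ys) ≡ 0
    sum-map-zero []       = refl
    sum-map-zero (_ ∷ ys) = sum-map-zero ys
sum-map-swap f (x ∷ xs) ys = trans (cong (sum (map (f x) ys) +_) (sum-map-swap f xs ys))
                                   (sym (sum-map-+ (f x) (λ y → sum (map (λ x → f x y) xs)) ys))

sum-map-mono : (f g : A → ℕ) {xs : List A} → (∀ {x} → x ∈ xs → f x ≤ g x) →
               sum (map f xs) ≤ sum (map g xs)
sum-map-mono f g {[]}     f≤g = z≤n
sum-map-mono f g {x ∷ xs} f≤g = +-mono-≤ (f≤g (here refl)) (sum-map-mono f g (f≤g ∘ there))

sum-map-mono-< : (f g : A → ℕ) {xs : List A} → (∀ {x} → x ∈ xs → f x ≤ g x) →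
                 ∀ {x₀} → x₀ ∈ xs → f x₀ < g x₀ → sum (map f xs) < sum (map g xs)
sum-map-mono-< f g f≤g (here refl) f<g = +-mono-<-≤ f<g (sum-map-mono f g (f≤g ∘ there))
sum-map-mono-< f g f≤g (there x∈)  f<g = +-mono-≤-< (f≤g (here refl)) (sum-map-mono-< f g (f≤g ∘ there) x∈ f<g)

sum-map-cong : (f g : A → ℕ) {xs : List A} → (∀ {x} → x ∈ xs → f x ≡ g x) →
               sum (map f xs) ≡ sum (map g xs)
sum-map-cong f g f≡g = ≤-antisym (sum-map-mono f g (≤-reflexive ∘ f≡g)) (sum-map-mono g f (≤-reflexive ∘ sym ∘ f≡g))

indicator : Bool → ℕ
indicator b = if b then 1 else 0

count : (A → Bool) → List A → ℕ
count p xs = sum (map (indicator ∘ p) xs)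

fibreSize : (A → ℕ) → List A → ℕ → ℕ
fibreSize f xs v = count (λ x → v ≡ᵇ f x) xs

multiplicity : List ℕ → ℕ → ℕ
multiplicity = fibreSize (λ x → x)

≡ᵇ-≡ : ∀ {a b} → a ≡ b → (a ≡ᵇ b) ≡ true
≡ᵇ-≡ {a} refl = Equivalence.to T-≡ (≡⇒≡ᵇ a a refl)

≡ᵇ-≢ : ∀ {a b} → a ≢ b → (a ≡ᵇ b) ≡ false
≡ᵇ-≢ {a} {b} a≢b with a ≡ᵇ b in a≡ᵇb
... | false = refl
... | true  = ⊥-elim (a≢b (≡ᵇ⇒≡ a b (Equivalence.from T-≡ a≡ᵇb)))

<ᵇ-true : ∀ {a b} → a < b → (a <ᵇ b) ≡ true
<ᵇ-true a<b = Equivalence.to T-≡ (<⇒<ᵇ a<b)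

<ᵇ-true⁻ : ∀ {a b} → (a <ᵇ b) ≡ true → a < b
<ᵇ-true⁻ {a} {b} a<ᵇb = <ᵇ⇒< a b (Equivalence.from T-≡ a<ᵇb)

<ᵇ-false : ∀ {a b} → b ≤ a → (a <ᵇ b) ≡ false
<ᵇ-false {a} {b} b≤a with a <ᵇ b in a<ᵇb
... | false = refl
... | true  = ⊥-elim (<⇒≱ (<ᵇ-true⁻ a<ᵇb) b≤a)

≤ᵇ-true : ∀ {a b} → a ≤ b → (a ≤ᵇ b) ≡ true
≤ᵇ-true a≤b = Equivalence.to T-≡ (≤⇒≤ᵇ a≤b)

indicator≤1 : ∀ b → indicator b ≤ 1
indicator≤1 true  = ≤-refl
indicator≤1 false = z≤n

indicator-≡ : ∀ {a b} → a ≡ b → indicator (a ≡ᵇ b) ≡ 1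
indicator-≡ a≡b rewrite ≡ᵇ-≡ a≡b = refl

indicator-≢ : ∀ {a b} → a ≢ b → indicator (a ≡ᵇ b) ≡ 0
indicator-≢ a≢b rewrite ≡ᵇ-≢ a≢b = refl

count-++ : (p : A → Bool) (xs ys : List A) → count p (xs ++ ys) ≡ count p xs + count p ys
count-++ p xs ys = trans (cong sum (map-++ (indicator ∘ p) xs ys)) (sum-++ (map (indicator ∘ p) xs) _)

count-map : (p : B → Bool) (f : A → B) (xs : List A) → count p (map f xs) ≡ count (p ∘ f) xs
count-map p f xs = cong sum (sym (map-∘ xs))

count-↭ : (p : A → Bool) {xs ys : List A} → xs ↭ ys → count p xs ≡ count p ys
count-↭ p xs↭ys = sum-↭ (↭.map⁺ (indicator ∘ p) xs↭ys)

count-none : (p : A → Bool) {xs : List A} → (∀ {x} → x ∈ xs → p x ≡ false) → count p xs ≡ 0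
count-none p {[]}     none = refl
count-none p {x ∷ xs} none rewrite none (here refl) = count-none p (none ∘ there)

count-all : (p : A → Bool) {xs : List A} → (∀ {x} → x ∈ xs → p x ≡ true) → count p xs ≡ length xs
count-all p {[]}     all = refl
count-all p {x ∷ xs} all rewrite all (here refl) = cong suc (count-all p (all ∘ there))

count-pos : (p : A → Bool) {xs : List A} {x : A} → x ∈ xs → p x ≡ true → 0 < count p xs
count-pos p {x ∷ xs} (here refl) px rewrite px = s≤s z≤n
count-pos p {y ∷ xs} (there x∈) px = <-≤-trans (count-pos p x∈ px) (m≤n+m _ (indicator (p y)))

range : ℕ → ℕ → List ℕ
range s zero    = []
range s (suc t) = s ∷ range (suc s) t

range-∷ʳ : ∀ s t → range s t ∷ʳ (s + t) ≡ range s (suc t)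
range-∷ʳ s zero    = cong (_∷ []) (+-identityʳ s)
range-∷ʳ s (suc t) = cong (s ∷_) (trans (cong (range (suc s) t ∷ʳ_) (+-suc s t)) (range-∷ʳ (suc s) t))

∈-range⁻ : ∀ {k} s t → k ∈ range s t → s ≤ k × k < s + t
∈-range⁻ s (suc t) (here refl) = ≤-refl , m<m+n s (s≤s z≤n)
∈-range⁻ {k} s (suc t) (there k∈) with ∈-range⁻ (suc s) t k∈
... | s<k , k< = <⇒≤ s<k , subst (k <_) (sym (+-suc s t)) k<

∈-range⁺ : ∀ {k} s t → s ≤ k → k < s + t → k ∈ range s t
∈-range⁺ {k} s zero    s≤k k< = ⊥-elim (<-irrefl refl (≤-<-trans s≤k (subst (k <_) (+-identityʳ s) k<)))
∈-range⁺ {k} s (suc t) s≤k k< with s ≟ k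
... | yes refl = here refl
... | no s≢k   = there (∈-range⁺ (suc s) t (≤∧≢⇒< s≤k s≢k) (subst (k <_) (+-suc s t) k<))

map-+-range : ∀ a s t → map (a +_) (range s t) ≡ range (a + s) t
map-+-range a s zero    = refl
map-+-range a s (suc t) = cong (a + s ∷_) (trans (map-+-range a (suc s) t) (cong (λ b → range b t) (+-suc a s)))

range-++ : ∀ s t u → range s (t + u) ≡ range s t ++ range (s + t) u
range-++ s zero    u = cong (λ b → range b u) (sym (+-identityʳ s))
range-++ s (suc t) u =
  cong (s ∷_) (trans (range-++ (suc s) t u) (cong (λ b → range (suc s) t ++ range b u) (sym (+-suc s t))))

applyUpTo-range : (f : ℕ → A) (t : ℕ) → applyUpTo f t ≡ map f (range 0 t)
applyUpTo-range f zero    = refl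
applyUpTo-range f (suc t) = cong (f 0 ∷_) (begin
    applyUpTo (f ∘ suc) t      ≡⟨ applyUpTo-range (f ∘ suc) t ⟩
    map (f ∘ suc) (range 0 t)  ≡⟨ map-∘ (range 0 t) ⟩
    map f (map suc (range 0 t)) ≡⟨ cong (map f) (map-+-range 1 0 t) ⟩
    map f (range 1 t)          ∎)
  where open ≡-Reasoning

map-+-upTo : ∀ a t → map (a +_) (upTo t) ≡ range a t
map-+-upTo a t = begin
  map (a +_) (upTo t)       ≡⟨ map-applyUpTo (λ x → x) (a +_) t ⟩
  applyUpTo (a +_) t        ≡⟨ applyUpTo-range (a +_) t ⟩
  map (a +_) (range 0 t)    ≡⟨ map-+-range a 0 t ⟩
  range (a + 0) t           ≡⟨ cong (λ b → range b t) (+-identityʳ a) ⟩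
  range a t                 ∎
  where open ≡-Reasoning

count-≡ᵇ-range : ∀ {a} s t → s ≤ a → a < s + t → count (_≡ᵇ a) (range s t) ≡ 1
count-≡ᵇ-range {a} s zero    s≤a a< = ⊥-elim (<-irrefl refl (≤-<-trans s≤a (subst (a <_) (+-identityʳ s) a<)))
count-≡ᵇ-range {a} s (suc t) s≤a a< with s ≟ a
... | yes refl rewrite ≡ᵇ-≡ {s} refl =
  cong suc (count-none (_≡ᵇ s) (λ v∈ → ≡ᵇ-≢ (>⇒≢ (proj₁ (∈-range⁻ (suc s) t v∈)))))
... | no s≢a rewrite ≡ᵇ-≢ s≢a = count-≡ᵇ-range (suc s) t (≤∧≢⇒< s≤a s≢a) (subst (a <_) (+-suc s t) a<)

sum-fibreSize : (f : A → ℕ) (xs : List A) (s t : ℕ) → (∀ {x} → x ∈ xs → s ≤ f x × f x < s + t) →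
                sum (map (fibreSize f xs) (range s t)) ≡ length xs
sum-fibreSize f xs s t inRange = begin
  sum (map (λ v → sum (map (λ x → indicator (v ≡ᵇ f x)) xs)) (range s t))
    ≡⟨ sum-map-swap (λ v x → indicator (v ≡ᵇ f x)) (range s t) xs ⟩
  sum (map (λ x → count (_≡ᵇ f x) (range s t)) xs)
    ≡⟨ sum-map-cong _ (λ _ → 1) (λ x∈ → count-≡ᵇ-range s t (proj₁ (inRange x∈)) (proj₂ (inRange x∈))) ⟩
  sum (map (λ _ → 1) xs)
    ≡⟨ count-all (λ _ → true) {xs} (λ _ → refl) ⟩
  length xs ∎
  where open ≡-Reasoning

length-range : ∀ s t → length (range s t) ≡ t
length-range s zero    = refl
length-range s (suc t) = cong suc (length-range (suc s) t)

∈-replicate⁻ : ∀ {x y : A} t → x ∈ replicate t y → x ≡ y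
∈-replicate⁻ (suc t) (here refl) = refl
∈-replicate⁻ (suc t) (there x∈) = ∈-replicate⁻ t x∈

∈-take⁻ : ∀ {x : A} t xs → x ∈ take t xs → x ∈ xs
∈-take⁻ (suc t) (y ∷ xs) (here refl) = here refl
∈-take⁻ (suc t) (y ∷ xs) (there x∈)  = there (∈-take⁻ t xs x∈)

count-take-++ : (p : A → Bool) (P Q : List A) (t : ℕ) → (∀ {x} → x ∈ P → p x ≡ true) →
                ∀ {y} → y ∈ take t (P ++ Q) → p y ≡ false → length P ≤ count p (take t (P ++ Q))
count-take-++ p []      Q t       allP y∈ py = z≤n
count-take-++ p (x ∷ P) Q (suc t) allP (here refl) py with () ← trans (sym py) (allP (here refl))
count-take-++ p (x ∷ P) Q (suc t) allP (there y∈)  py rewrite allP (here refl) =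
  s≤s (count-take-++ p P Q t (allP ∘ there) y∈ py)

sort-↭-ascending : ∀ {xs ys} → xs ↭ ys → Linked _≤_ ys → sort xs ≡ ys
sort-↭-ascending {xs} xs↭ys ys↗ =
  Pointwise-≡⇒≡ (Sorted.↗↭↗⇒≋ ≤-totalOrder (Sort.sort-↗ xs) ys↗
                                (↭⇒↭ₛ (↭-trans (Sort.sort-↭ xs) xs↭ys)))

toList-lookup : ∀ {t} (v : Vec ℕ t) s (f : ℕ → ℕ) → (∀ r → Vec.lookup v r ≡ f (s + toℕ r)) →
                toList v ≡ map f (range s t)
toList-lookup Vec.[]       s f lookup≡ = refl
toList-lookup (x Vec.∷ v) s f lookup≡ =
  cong₂ _∷_ (trans (lookup≡ Fin.zero) (cong f (+-identityʳ s)))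
            (toList-lookup v (suc s) f (λ r → trans (lookup≡ (Fin.suc r)) (cong f (+-suc s (toℕ r)))))

-- Multiplicities and grevlex

_◁_ : List ℕ → List ℕ → Set
xs ◁ ys = ∃[ v ] (∀ w → w < v → multiplicity xs w ≡ multiplicity ys w) × multiplicity xs v < multiplicity ys v

◁-resp-↭ : ∀ {xs xs′ ys ys′} → xs ↭ xs′ → ys ↭ ys′ → xs ◁ ys → xs′ ◁ ys′
◁-resp-↭ xs↭ ys↭ (v , below , at) =
  v , (λ w w<v → subst₂ _≡_ (count-↭ (w ≡ᵇ_) xs↭) (count-↭ (w ≡ᵇ_) ys↭) (below w w<v)) ,
      subst₂ _<_ (count-↭ (v ≡ᵇ_) xs↭) (count-↭ (v ≡ᵇ_) ys↭) at

head-minimal : ∀ {y ys} → Linked _≤_ (y ∷ ys) → ∀ {z} → z ∈ y ∷ ys → y ≤ z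
head-minimal sorted = All.lookup (Linked⇒All ≤-trans ≤-refl sorted)

sorted-◁⇒firstDiffGreater : ∀ {xs ys} → Linked _≤_ xs → Linked _≤_ ys → length xs ≡ length ys →
                            xs ◁ ys → FirstDiffGreater xs ys
sorted-◁⇒firstDiffGreater {[]}     {[]}     _ _ _ (v , _ , ())
sorted-◁⇒firstDiffGreater {x ∷ xs} {y ∷ ys} xs↗ ys↗ len (v , below , at) with <-cmp x y
... | tri> _ _ y<x = inj₂ y<x
... | tri≈ _ refl _ = inj₁ (refl , sorted-◁⇒firstDiffGreater (Linked.tail xs↗) (Linked.tail ys↗) (suc-injective len)
                                     (v , (λ w w<v → +-cancelˡ-≡ _ _ _ (below w w<v)) , +-cancelˡ-< _ _ _ at))
... | tri< x<y _ _ = ⊥-elim contradiction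
  where
    -- no value ≤ x occurs in y ∷ ys, yet x occurs in x ∷ xs
    absent : ∀ w → w ≤ x → multiplicity (y ∷ ys) w ≡ 0
    absent w w≤x = count-none (w ≡ᵇ_) (λ z∈ → ≡ᵇ-≢ (<⇒≢ (≤-<-trans w≤x (<-≤-trans x<y (head-minimal ys↗ z∈)))))
    contradiction : ⊥
    contradiction with <-cmp x v
    ... | tri< x<v _ _ = <-irrefl (sym (absent x ≤-refl))
                            (<-≤-trans (count-pos (x ≡ᵇ_) {x ∷ xs} (here refl) (≡ᵇ-≡ {x} refl))
                                       (≤-reflexive (below x x<v)))
    ... | tri≈ _ x≡v _ = n≮0 (subst (multiplicity (x ∷ xs) v <_) (absent v (≤-reflexive (sym x≡v))) at)
    ... | tri> _ _ v<x = n≮0 (subst (multiplicity (x ∷ xs) v <_) (absent v (<⇒≤ v<x)) at)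

◁⇒≺ : (xs μ : List ℕ) → Linked _≤_ (reverse μ) → length xs ≡ length μ → sum xs ≡ sum μ →
      xs ◁ μ → reverse (sort xs) ≺ μ
◁⇒≺ xs μ μ↘ len sum≡ xs◁μ = inj₂ (sum-sorted , lastDiffPositive)
  where
    sum-sorted : sum (reverse (sort xs)) ≡ sum μ
    sum-sorted = trans (sum-↭ (↭-trans (↭.↭-reverse (sort xs)) (Sort.sort-↭ xs))) sum≡
    lastDiffPositive : LastDiffPositive (reverse (sort xs)) μ
    lastDiffPositive rewrite reverse-involutive (sort xs) =
      sorted-◁⇒firstDiffGreater (Sort.sort-↗ xs) μ↘
        (trans (↭.↭-length (Sort.sort-↭ xs)) (trans len (sym (length-reverse μ))))
        (◁-resp-↭ (↭-sym (Sort.sort-↭ xs)) (↭-sym (↭.↭-reverse μ)) xs◁μ)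

◁-irrefl : ∀ {xs} → ¬ xs ◁ xs
◁-irrefl (_ , _ , at) = <-irrefl refl at

map-◁ : (f g : A → ℕ) (xs : List A) (v : ℕ) →
        (∀ {x} → x ∈ xs → f x ≡ g x ⊎ (v ≤ f x × v ≤ g x × (f x ≡ v → g x ≡ v))) →
        ∀ {x₀} → x₀ ∈ xs → g x₀ ≡ v → v < f x₀ → map f xs ◁ map g xs
map-◁ f g xs v compare {x₀} x₀∈ gx₀≡v v<fx₀ = v , below , at
  where
    below : ∀ w → w < v → multiplicity (map f xs) w ≡ multiplicity (map g xs) w
    below w w<v = begin
      multiplicity (map f xs) w ≡⟨ count-map (w ≡ᵇ_) f xs ⟩
      count (λ x → w ≡ᵇ f x) xs  ≡⟨ sum-map-cong _ _ agree ⟩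
      count (λ x → w ≡ᵇ g x) xs  ≡⟨ count-map (w ≡ᵇ_) g xs ⟨
      multiplicity (map g xs) w ∎
      where
        open ≡-Reasoning
        agree : ∀ {x} → x ∈ xs → indicator (w ≡ᵇ f x) ≡ indicator (w ≡ᵇ g x)
        agree x∈ with compare x∈
        ... | inj₁ fx≡gx = cong (λ y → indicator (w ≡ᵇ y)) fx≡gx
        ... | inj₂ (v≤fx , v≤gx , _) = trans (indicator-≢ (<⇒≢ (<-≤-trans w<v v≤fx)))
                                            (sym (indicator-≢ (<⇒≢ (<-≤-trans w<v v≤gx))))
    at : multiplicity (map f xs) v < multiplicity (map g xs) v
    at = subst₂ _<_ (sym (count-map (v ≡ᵇ_) f xs)) (sym (count-map (v ≡ᵇ_) g xs))
                    (sum-map-mono-< _ _ atMost x₀∈ strictly)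
      where
        atMost : ∀ {x} → x ∈ xs → indicator (v ≡ᵇ f x) ≤ indicator (v ≡ᵇ g x)
        atMost {x} x∈ with compare x∈ | f x ≟ v
        ... | inj₁ fx≡gx | _ = ≤-reflexive (cong (λ y → indicator (v ≡ᵇ y)) fx≡gx)
        ... | inj₂ _ | no fx≢v rewrite indicator-≢ (fx≢v ∘ sym) = z≤n
        ... | inj₂ (_ , _ , fx≡v⇒gx≡v) | yes fx≡v
          rewrite indicator-≡ (sym fx≡v) | indicator-≡ (sym (fx≡v⇒gx≡v fx≡v)) = ≤-refl
        strictly : indicator (v ≡ᵇ f x₀) < indicator (v ≡ᵇ g x₀)
        strictly rewrite indicator-≢ (<⇒≢ v<fx₀) | indicator-≡ (sym gx₀≡v) = s≤s z≤n

-- Expanding a product of differences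

-- a term of the expansion of ∏ (x_i - x_j) picks, for each edge (i , j), x_i (false) or - x_j (true)
Pick : Set
Pick = (ℕ × ℕ) × Bool

pickedVar : Pick → ℕ
pickedVar ((i , j) , false) = i
pickedVar ((i , j) , true)  = j

pickSign : Pick → ℤ
pickSign (_ , false) = 1ℤ
pickSign (_ , true)  = ℤ.-1ℤ

picks : List (ℕ × ℕ) → List (List Pick)
picks []       = [] ∷ []
picks (e ∷ es) = map ((e , false) ∷_) (picks es) ++ map ((e , true) ∷_) (picks es)

leftPicks : List (ℕ × ℕ) → List Pick
leftPicks = map (_, false)

Pickedʳ : List Pick → Set
Pickedʳ ps = ∃[ p ] p ∈ ps × proj₂ p ≡ true

picks-edges : ∀ es {ps} → ps ∈ picks es → map proj₁ ps ≡ es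
picks-edges []       (here refl) = refl
picks-edges (e ∷ es) ps∈ with ∈-++⁻ (map ((e , false) ∷_) (picks es)) ps∈
... | inj₁ ∈left  with ∈-map⁻ ((e , false) ∷_) ∈left
...   | ps , ps∈′ , refl = cong (e ∷_) (picks-edges es ps∈′)
picks-edges (e ∷ es) ps∈ | inj₂ ∈right with ∈-map⁻ ((e , true) ∷_) ∈right
...   | ps , ps∈′ , refl = cong (e ∷_) (picks-edges es ps∈′)

picks-leftPicks : ∀ es → ∃[ others ] picks es ≡ leftPicks es ∷ others × (∀ {ps} → ps ∈ others → Pickedʳ ps)
picks-leftPicks []       = [] , refl , λ ()
picks-leftPicks (e ∷ es) with picks-leftPicks es
... | others , eq , othersʳ rewrite eq =
  map ((e , false) ∷_) others ++ map ((e , true) ∷_) (leftPicks es ∷ others) , refl , pickedʳ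
  where
    pickedʳ : ∀ {ps} → ps ∈ map ((e , false) ∷_) others ++ map ((e , true) ∷_) (leftPicks es ∷ others) → Pickedʳ ps
    pickedʳ ps∈ with ∈-++⁻ (map ((e , false) ∷_) others) ps∈
    ... | inj₁ ∈left with ∈-map⁻ ((e , false) ∷_) ∈left
    ...   | _ , ps∈′ , refl with othersʳ ps∈′
    ...     | p , p∈ , pʳ = p , there p∈ , pʳ
    pickedʳ ps∈ | inj₂ ∈right with ∈-map⁻ ((e , true) ∷_) ∈right
    ...   | _ , _ , refl = (e , true) , here refl , refl

coeff-∷-≡ : ∀ {k} a {β α : Vec ℕ k} (P : Poly k) → β ≡ α → coeff ((a , β) ∷ P) α ≡ a ℤ.+ coeff P α
coeff-∷-≡ a {β} {α} P β≡α with Vec.≡-dec _≟_ β α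
... | yes _   = refl
... | no β≢α = ⊥-elim (β≢α β≡α)

coeff-∷-≢ : ∀ {k} a {β α : Vec ℕ k} (P : Poly k) → β ≢ α → coeff ((a , β) ∷ P) α ≡ coeff P α
coeff-∷-≢ a {β} {α} P β≢α with Vec.≡-dec _≟_ β α
... | yes β≡α = ⊥-elim (β≢α β≡α)
... | no _    = refl

coeff-absent : ∀ {k} (P : Poly k) {α} → (∀ {t} → t ∈ P → proj₂ t ≢ α) → coeff P α ≡ 0ℤ
coeff-absent []            absent = refl
coeff-absent ((a , β) ∷ P) absent = trans (coeff-∷-≢ a P (absent (here refl))) (coeff-absent P (absent ∘ there))

coeff-≢0 : ∀ {k} (P : Poly k) {α} → coeff P α ≢ 0ℤ → ∃[ t ] t ∈ P × proj₂ t ≡ α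
coeff-≢0 []            c≢0 = ⊥-elim (c≢0 refl)
coeff-≢0 ((a , β) ∷ P) {α} c≢0 with Vec.≡-dec _≟_ β α
... | yes β≡α = _ , here refl , β≡α
... | no _ with coeff-≢0 P c≢0
...   | t , t∈ , t≡α = t , there t∈ , t≡α

module Expansion (k : ℕ) where

  exponent : List Pick → Vec ℕ k
  exponent []       = Vec.replicate k 0
  exponent (p ∷ ps) = Vec.zipWith _+_ (unitExp k (pickedVar p)) (exponent ps)

  sign : List Pick → ℤ
  sign []       = 1ℤ
  sign (p ∷ ps) = pickSign p ℤ.* sign ps

  monomial : List Pick → ℤ × Vec ℕ k
  monomial ps = sign ps , exponent ps

  ∏-diffPoly : List (ℕ × ℕ) → Poly k
  ∏-diffPoly = foldr (λ e acc → mulPoly (diffPoly k (proj₁ e) (proj₂ e)) acc) one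

  ∏-diffPoly-picks : ∀ es → ∏-diffPoly es ≡ map monomial (picks es)
  ∏-diffPoly-picks []       = refl
  ∏-diffPoly-picks (e ∷ es) = begin
    mulPoly (diffPoly k (proj₁ e) (proj₂ e)) (∏-diffPoly es)
      ≡⟨ cong (mulPoly (diffPoly k (proj₁ e) (proj₂ e))) (∏-diffPoly-picks es) ⟩
    mulPoly (diffPoly k (proj₁ e) (proj₂ e)) (map monomial (picks es))
      ≡⟨ cong₂ _++_ (regroup (λ _ → refl)) (trans (++-identityʳ _) (regroup (λ _ → refl))) ⟩
    map monomial (map ((e , false) ∷_) (picks es)) ++ map monomial (map ((e , true) ∷_) (picks es))
      ≡⟨ sym (map-++ monomial (map ((e , false) ∷_) (picks es)) _) ⟩
    map monomial (picks (e ∷ es)) ∎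
    where
      open ≡-Reasoning
      regroup : ∀ {f : ℤ × Vec ℕ k → ℤ × Vec ℕ k} {h : List Pick → List Pick} → f ∘ monomial ≗ monomial ∘ h →
                map f (map monomial (picks es)) ≡ map monomial (map h (picks es))
      regroup fh = trans (sym (map-∘ (picks es))) (trans (map-cong fh (picks es)) (map-∘ (picks es)))

  sign-leftPicks : ∀ es → sign (leftPicks es) ≡ 1ℤ
  sign-leftPicks []       = refl
  sign-leftPicks (e ∷ es) = trans (ℤ.*-identityˡ _) (sign-leftPicks es)

  toList-exponent : ∀ ps → toList (exponent ps) ≡ map (fibreSize pickedVar ps) (range 1 k)
  toList-exponent ps = toList-lookup (exponent ps) 1 (fibreSize pickedVar ps) (lookup-exponent ps)
    where
      lookup-exponent : ∀ ps r → Vec.lookup (exponent ps) r ≡ fibreSize pickedVar ps (suc (toℕ r))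
      lookup-exponent []       r = Vec.lookup-replicate r 0
      lookup-exponent (p ∷ ps) r = trans (Vec.lookup-zipWith _+_ r (unitExp k (pickedVar p)) (exponent ps))
                                         (cong₂ _+_ (Vec.lookup∘tabulate _ r) (lookup-exponent ps r))

-- The domination argument

left right : Pick → ℕ
left  = proj₁ ∘ proj₁
right = proj₂ ∘ proj₁

pickedVar-right : ∀ {p} → proj₂ p ≡ true → pickedVar p ≡ right p
pickedVar-right {_ , true} refl = refl

rightmost : List Pick → ℕ
rightmost []                 = 0
rightmost ((e , false) ∷ ps) = rightmost ps
rightmost ((e , true)  ∷ ps) = proj₂ e ⊔ rightmost ps

rightmost-≥ : ∀ {ps p} → p ∈ ps → proj₂ p ≡ true → right p ≤ rightmost ps
rightmost-≥ {((i , r) , true)  ∷ ps} (here refl) _  = m≤m⊔n r _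
rightmost-≥ {((i , r) , true)  ∷ ps} (there p∈) pʳ = ≤-trans (rightmost-≥ p∈ pʳ) (m≤n⊔m r _)
rightmost-≥ {((i , r) , false) ∷ ps} (here refl) ()
rightmost-≥ {((i , r) , false) ∷ ps} (there p∈) pʳ = rightmost-≥ p∈ pʳ

RightmostAttained : List Pick → Set
RightmostAttained ps = ∃[ p ] p ∈ ps × proj₂ p ≡ true × right p ≡ rightmost ps

rightmost-attained-or-zero : ∀ ps → RightmostAttained ps ⊎ rightmost ps ≡ 0
rightmost-attained-or-zero [] = inj₂ refl
rightmost-attained-or-zero (((i , r) , false) ∷ ps) with rightmost-attained-or-zero ps
... | inj₁ (p , p∈ , pʳ , p≡) = inj₁ (p , there p∈ , pʳ , p≡)
... | inj₂ ≡0                 = inj₂ ≡0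
rightmost-attained-or-zero (((i , r) , true) ∷ ps) with rightmost-attained-or-zero ps | ≤-total r (rightmost ps)
... | inj₁ (p , p∈ , pʳ , p≡) | inj₁ r≤ = inj₁ (p , there p∈ , pʳ , trans p≡ (sym (m≤n⇒m⊔n≡n r≤)))
... | inj₂ ≡0                 | inj₁ r≤ = inj₁ (_ , here refl , refl , sym (trans (cong (r ⊔_) ≡0) (⊔-identityʳ r)))
... | _                       | inj₂ ≤r = inj₁ (_ , here refl , refl , sym (m≥n⇒m⊔n≡m ≤r))

rightmost-attained : ∀ ps → Pickedʳ ps → RightmostAttained ps
rightmost-attained ps (p , p∈ , pʳ) with rightmost-attained-or-zero ps
... | inj₁ attained = attained
... | inj₂ ≡0       = p , p∈ , pʳ , trans (n≤0⇒n≡0 (subst (right p ≤_) ≡0 (rightmost-≥ p∈ pʳ))) (sym ≡0)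

outDegree : List (ℕ × ℕ) → ℕ → ℕ
outDegree = fibreSize proj₁

longerThan : ℕ → ℕ → ℕ × ℕ → Bool
longerThan i j e = (i ≡ᵇ proj₁ e) ∧ (j <ᵇ proj₂ e)

module Domination (ℓ m n : ℕ) (ℓ≥1 : 1 ≤ ℓ) (G : List (ℕ × ℕ))
  (edge-bounds : ∀ {e} → e ∈ G → 1 ≤ proj₁ e × proj₁ e ≤ n × proj₁ e < proj₂ e × proj₂ e ≤ suc n)
  (outDegree-antitone : ∀ {k j} → 1 ≤ k → k ≤ j → j ≤ n → outDegree G j ≤ outDegree G k)
  (outDegree-staircase : ∀ {j} → 1 ≤ j → j ≤ n → outDegree G j ≤ (ℓ ∸ 1) + m * (n ∸ j))
  (long-edges : ∀ {e} → e ∈ G → ∀ {j} → proj₂ e ≤ j → j ≤ n →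
                ℓ + m * (n ∸ j) ≤ count (longerThan (proj₁ e) j) G)
  where

  module _ (ps : List Pick) (ps-edges : map proj₁ ps ≡ G) (ps-pickedʳ : Pickedʳ ps)
           (no-last-variable : fibreSize pickedVar ps (suc n) ≡ 0) where

    private
      expo deg : ℕ → ℕ
      expo = fibreSize pickedVar ps
      deg  = outDegree G

      j : ℕ
      j = rightmost ps

    count-edges : (q : ℕ × ℕ → Bool) → count q G ≡ count (q ∘ proj₁) ps
    count-edges q = trans (cong (count q) (sym ps-edges)) (count-map q proj₁ ps)

    pick-bounds : ∀ {p} → p ∈ ps → 1 ≤ left p × left p ≤ n × left p < right p × right p ≤ suc n
    pick-bounds p∈ = edge-bounds (subst (_ ∈_) ps-edges (∈-map⁺ proj₁ p∈))

    left<right : ∀ {p} → p ∈ ps → left p < right p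
    left<right = proj₁ ∘ proj₂ ∘ proj₂ ∘ pick-bounds

    1≤j×j≤n : 1 ≤ j × j ≤ n
    1≤j×j≤n with rightmost-attained ps ps-pickedʳ
    ... | p , p∈ , pʳ , p≡j with pick-bounds p∈
    ...   | 1≤left , _ , left<right , right≤1+n =
      ≤-trans 1≤left (<⇒≤ (subst (left p <_) p≡j left<right)) ,
      ≤-pred (≤∧≢⇒< (subst (_≤ suc n) p≡j right≤1+n) j≢1+n)
      where
        j≢1+n : j ≢ suc n
        j≢1+n j≡1+n = n≮0 (subst (0 <_) no-last-variable
                        (count-pos (λ q → suc n ≡ᵇ pickedVar q) p∈
                          (≡ᵇ-≡ (sym (trans (pickedVar-right pʳ) (trans p≡j j≡1+n))))))

    deg-picks : ∀ k → deg k ≡ count (λ p → k ≡ᵇ left p) ps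
    deg-picks k = count-edges (λ e → k ≡ᵇ proj₁ e)

    expo-above : ∀ {k} → j < k → expo k ≡ deg k
    expo-above {k} j<k = trans (sum-map-cong _ _ agree) (sym (deg-picks k))
      where
        agree : ∀ {p} → p ∈ ps → indicator (k ≡ᵇ pickedVar p) ≡ indicator (k ≡ᵇ left p)
        agree {_ , false} _  = refl
        agree {(i , r) , true} p∈ = trans (indicator-≢ (>⇒≢ r<k)) (sym (indicator-≢ (>⇒≢ (<-trans (left<right p∈) r<k))))
          where
            r<k : r < k
            r<k = ≤-<-trans (rightmost-≥ p∈ refl) j<k

    deg<expo-rightmost : deg j < expo j
    deg<expo-rightmost with rightmost-attained ps ps-pickedʳ
    ... | pⱼ , pⱼ∈ , pⱼʳ , pⱼ≡j = subst (_< expo j) (sym (deg-picks j)) (sum-map-mono-< _ _ atMost pⱼ∈ strictly)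
      where
        j≢left : ∀ {p} → p ∈ ps → proj₂ p ≡ true → j ≢ left p
        j≢left p∈ pʳ = >⇒≢ (<-≤-trans (left<right p∈) (rightmost-≥ p∈ pʳ))
        atMost : ∀ {p} → p ∈ ps → indicator (j ≡ᵇ left p) ≤ indicator (j ≡ᵇ pickedVar p)
        atMost {_ , false} _  = ≤-refl
        atMost {_ , true}  p∈ rewrite indicator-≢ (j≢left p∈ refl) = z≤n
        strictly : indicator (j ≡ᵇ left pⱼ) < indicator (j ≡ᵇ pickedVar pⱼ)
        strictly = subst₂ _<_ (sym (indicator-≢ (j≢left pⱼ∈ pⱼʳ)))
                              (sym (indicator-≡ (sym (trans (pickedVar-right pⱼʳ) pⱼ≡j)))) (s≤s z≤n)

    -- a right pick leaving k forces every edge from k that jumps past j to be picked left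
    deg-j<expo : ∀ {p} → p ∈ ps → proj₂ p ≡ true → deg j < expo (left p)
    deg-j<expo {p} p∈ pʳ = begin-strict
      deg j                              ≤⟨ outDegree-staircase (proj₁ 1≤j×j≤n) (proj₂ 1≤j×j≤n) ⟩
      (ℓ ∸ 1) + m * (n ∸ j)              <⟨ +-monoˡ-< (m * (n ∸ j)) (∸-monoʳ-< {o = 0} (s≤s z≤n) ℓ≥1) ⟩
      ℓ + m * (n ∸ j)                    ≤⟨ long-edges (subst (_ ∈_) ps-edges (∈-map⁺ proj₁ p∈))
                                                       (rightmost-≥ p∈ pʳ) (proj₂ 1≤j×j≤n) ⟩
      count (longerThan k j) G           ≡⟨ count-edges (longerThan k j) ⟩
      count (longerThan k j ∘ proj₁) ps  ≤⟨ sum-map-mono _ _ longPickedLeft ⟩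
      expo k                             ∎
      where
        open ≤-Reasoning
        k : ℕ
        k = left p
        longPickedLeft : ∀ {q} → q ∈ ps → indicator (longerThan k j (proj₁ q)) ≤ indicator (k ≡ᵇ pickedVar q)
        longPickedLeft {(i , r) , false} _ with k ≡ᵇ i
        ... | false = z≤n
        ... | true  = indicator≤1 (j <ᵇ r)
        longPickedLeft {(i , r) , true} q∈ with j <ᵇ r in j<ᵇr
        ... | false rewrite ∧-zeroʳ (k ≡ᵇ i) = z≤n
        ... | true  = ⊥-elim (<⇒≱ (<ᵇ-true⁻ j<ᵇr) (rightmost-≥ q∈ refl))

    expo-below : ∀ {k} → k ≤ j → deg j < expo k ⊎ deg k ≤ expo k
    expo-below {k} k≤j with any? (λ p → (proj₂ p ≟ᴮ true) ×-dec (left p ≟ k)) ps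
    ... | yes leavesk with find leavesk
    ...   | p , p∈ , pʳ , refl = inj₁ (deg-j<expo p∈ pʳ)
    expo-below {k} k≤j | no ¬leavesk = inj₂ (subst (_≤ expo k) (sym (deg-picks k)) (sum-map-mono _ _ atMost))
      where
        atMost : ∀ {p} → p ∈ ps → indicator (k ≡ᵇ left p) ≤ indicator (k ≡ᵇ pickedVar p)
        atMost {_ , false} _  = ≤-refl
        atMost {_ , true}  p∈ rewrite indicator-≢ (λ k≡left → ¬leavesk (lose p∈ (refl , sym k≡left))) = z≤n

    deg-j≤ : ∀ {k} → k ∈ range 1 n → k ≤ j → deg j ≤ deg k
    deg-j≤ k∈ k≤j = outDegree-antitone (proj₁ (∈-range⁻ 1 n k∈)) k≤j (proj₂ 1≤j×j≤n)

    exponents-◁-outDegrees : map expo (range 1 n) ◁ map deg (range 1 n)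
    exponents-◁-outDegrees = map-◁ expo deg (range 1 n) (deg j) compare
                               (∈-range⁺ 1 n (proj₁ 1≤j×j≤n) (s≤s (proj₂ 1≤j×j≤n))) refl deg<expo-rightmost
      where
        compare : ∀ {k} → k ∈ range 1 n →
                  expo k ≡ deg k ⊎ (deg j ≤ expo k × deg j ≤ deg k × (expo k ≡ deg j → deg k ≡ deg j))
        compare {k} k∈ with ≤-<-connex k j
        ... | inj₂ j<k = inj₁ (expo-above j<k)
        ... | inj₁ k≤j with expo-below k≤j
        ...   | inj₁ degj<expok = inj₂ (<⇒≤ degj<expok , deg-j≤ k∈ k≤j ,
                                       λ expok≡degj → ⊥-elim (<-irrefl (sym expok≡degj) degj<expok))
        ...   | inj₂ degk≤expok = inj₂ (≤-trans (deg-j≤ k∈ k≤j) degk≤expok , deg-j≤ k∈ k≤j ,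
                                       λ expok≡degj → ≤-antisym (subst (deg k ≤_) expok≡degj degk≤expok) (deg-j≤ k∈ k≤j))

    sum-exponents≡sum-outDegrees : sum (map expo (range 1 n)) ≡ sum (map deg (range 1 n))
    sum-exponents≡sum-outDegrees = begin
      sum (map expo (range 1 n))                ≡⟨ +-identityʳ _ ⟨
      sum (map expo (range 1 n)) + 0            ≡⟨ cong (sum (map expo (range 1 n)) +_) no-last-variable ⟨
      sum (map expo (range 1 n)) + expo (suc n) ≡⟨ sum-map-∷ʳ expo (range 1 n) (suc n) ⟨
      sum (map expo (range 1 n ∷ʳ suc n))       ≡⟨ cong (sum ∘ map expo) (range-∷ʳ 1 n) ⟩
      sum (map expo (range 1 (suc n)))          ≡⟨ sum-fibreSize pickedVar ps 1 (suc n) pickedVar-bounds ⟩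
      length ps                                 ≡⟨ length-map proj₁ ps ⟨
      length (map proj₁ ps)                     ≡⟨ cong length ps-edges ⟩
      length G                                  ≡⟨ sum-fibreSize proj₁ G 1 n left-bounds ⟨
      sum (map deg (range 1 n))                 ∎
      where
        open ≡-Reasoning
        pickedVar-bounds : ∀ {p} → p ∈ ps → 1 ≤ pickedVar p × pickedVar p < 1 + suc n
        pickedVar-bounds {_ , false} p∈ with pick-bounds p∈
        ... | 1≤i , i≤n , _ , _ = 1≤i , s≤s (m≤n⇒m≤1+n i≤n)
        pickedVar-bounds {_ , true}  p∈ with pick-bounds p∈
        ... | 1≤i , _ , i<r , r≤1+n = ≤-trans 1≤i (<⇒≤ i<r) , s≤s r≤1+n
        left-bounds : ∀ {e} → e ∈ G → 1 ≤ proj₁ e × proj₁ e < 1 + n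
        left-bounds e∈ = proj₁ (edge-bounds e∈) , s≤s (proj₁ (proj₂ (edge-bounds e∈)))

module Staircase (ℓ m : ℕ) where

  -- satisfied by the (shifted) abscissae of the north steps of a Dyck path, from height y on
  LeftOfLineFrom : ℕ → List ℕ → Set
  LeftOfLineFrom y []       = ⊤
  LeftOfLineFrom y (x ∷ xs) = x ≤ m * y + (ℓ ∸ 1) × All (x ≤_) xs × LeftOfLineFrom (suc y) xs

  -- SubStaircase 0 λ: λ is a partition and sub-(ℓ,m)-staircase; k counts further parts below λ
  SubStaircase : ℕ → List ℕ → Set
  SubStaircase k []       = ⊤
  SubStaircase k (x ∷ xs) = x ≤ (ℓ ∸ 1) + m * (length xs + k) × All (_≤ x) xs × SubStaircase k xs

  northXs-leftOfLine : ∀ {n} x y s → DyckFrom ℓ m n x y s → x ≤ m * y + (ℓ ∸ 1) →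
                       LeftOfLineFrom y (northXs x s) × All (x ≤_) (northXs x s) × length (northXs x s) + y ≡ n
  northXs-leftOfLine x y []      (_ , y≡n) _    = _ , [] , y≡n
  northXs-leftOfLine x y (N ∷ s) path      x≤ with northXs-leftOfLine x (suc y) s path
                                                     (≤-trans x≤ (+-monoˡ-≤ (ℓ ∸ 1) (*-monoʳ-≤ m (n≤1+n y))))
  ... | line , above , len = (x≤ , above , line) , ≤-refl ∷ above , trans (sym (+-suc _ y)) len
  northXs-leftOfLine x y (E ∷ s) (x< , path) _ with northXs-leftOfLine (suc x) y s path x<
  ... | line , above , len = line , All.map <⇒≤ above , len

  leftOfLine-ascending : ∀ y xs → LeftOfLineFrom y xs → Linked _≤_ xs
  leftOfLine-ascending y []           _                    = []
  leftOfLine-ascending y (x ∷ [])     _                    = [-]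
  leftOfLine-ascending y (x ∷ z ∷ zs) (_ , x≤z ∷ _ , line) = x≤z ∷ leftOfLine-ascending (suc y) (z ∷ zs) line

  subStaircase-∷ʳ : ∀ k ys x → SubStaircase (suc k) ys → x ≤ (ℓ ∸ 1) + m * k → All (x ≤_) ys →
                    SubStaircase k (ys ∷ʳ x)
  subStaircase-∷ʳ k []       x _                    x≤ _              = x≤ , [] , _
  subStaircase-∷ʳ k (y ∷ ys) x (y≤ , below , stair) x≤ (x≤y ∷ above) =
    subst (λ t → y ≤ (ℓ ∸ 1) + m * t) (sym length≡) y≤ ,
    All.∷ʳ⁺ below x≤y ,
    subStaircase-∷ʳ k ys x stair x≤ above
    where
      length≡ : length (ys ∷ʳ x) + k ≡ length ys + suc k
      length≡ = trans (cong (_+ k) (length-++ ys)) (+-assoc (length ys) 1 k)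

  reverse-subStaircase : ∀ y xs → LeftOfLineFrom y xs → SubStaircase y (reverse xs)
  reverse-subStaircase y []       _                    = _
  reverse-subStaircase y (x ∷ xs) (x≤ , above , line) =
    subst (SubStaircase y) (sym (unfold-reverse x xs))
      (subStaircase-∷ʳ y (reverse xs) x (reverse-subStaircase (suc y) xs line) (subst (x ≤_) (+-comm (m * y) (ℓ ∸ 1)) x≤)
         (↭.All-resp-↭ (↭-sym (↭.↭-reverse xs)) above))

-- The rows of G(D)

module Rows (ℓ m n : ℕ) (ℓ≥1 : 1 ≤ ℓ) (m≥1 : 1 ≤ m) where

  edgesTo : ℕ → List ℕ → List (ℕ × ℕ)
  edgesTo i = concatMap (λ j → replicate m (i , j))

  ∈-edgesTo⁻ : ∀ {e} i js → e ∈ edgesTo i js → ∃[ j ] j ∈ js × e ≡ (i , j)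
  ∈-edgesTo⁻ i (j ∷ js) e∈ with ∈-++⁻ (replicate m (i , j)) e∈
  ... | inj₁ e∈j  = j , here refl , ∈-replicate⁻ m e∈j
  ... | inj₂ e∈js with ∈-edgesTo⁻ i js e∈js
  ...   | j′ , j′∈ , e≡ = j′ , there j′∈ , e≡

  length-edgesTo : ∀ i js → length (edgesTo i js) ≡ m * length js
  length-edgesTo i []       = sym (*-zeroʳ m)
  length-edgesTo i (j ∷ js) = trans (length-++ (replicate m (i , j)))
                                    (trans (cong₂ _+_ (length-replicate m) (length-edgesTo i js)) (sym (*-suc m (length js))))

  middle : ℕ → List ℕ
  middle i = reverse (range (i + 2) (n ∸ (i + 1)))

  rowLabels-last : rowLabels ℓ m n n ≡ replicate (ℓ ∸ 1) (n , suc n)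
  rowLabels-last rewrite ≡ᵇ-≡ {n} refl = refl

  rowLabels-≢ : ∀ {i} → i ≢ n →
                rowLabels ℓ m n i ≡ replicate ℓ (i , suc n) ++ edgesTo i (middle i) ++ replicate (m ∸ 1) (i , suc i)
  rowLabels-≢ {i} i≢n rewrite ≡ᵇ-≢ i≢n =
    cong (λ js → replicate ℓ (i , suc n) ++ edgesTo i (reverse js) ++ replicate (m ∸ 1) (i , suc i))
         (map-+-upTo (i + 2) c)
    where
      c : ℕ
      c = n ∸ (i + 1)

  2+i+gap : ∀ {i} → i < n → i + 2 + (n ∸ (i + 1)) ≡ suc n
  2+i+gap {i} i<n = trans (cong (_+ (n ∸ (i + 1))) (+-suc i 1)) (cong suc (m+[n∸m]≡n (subst (_≤ n) (+-comm 1 i) i<n)))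

  rowLabels-edge : ∀ {i e} → i ≤ n → e ∈ rowLabels ℓ m n i → proj₁ e ≡ i × i < proj₂ e × proj₂ e ≤ suc n
  rowLabels-edge {i} {e} i≤n e∈ with i ≟ n
  ... | yes refl rewrite ∈-replicate⁻ (ℓ ∸ 1) (subst (e ∈_) rowLabels-last e∈) = refl , ≤-refl , ≤-refl
  ... | no i≢n with ∈-++⁻ (replicate ℓ (i , suc n)) (subst (e ∈_) (rowLabels-≢ i≢n) e∈)
  ...   | inj₁ e∈last rewrite ∈-replicate⁻ ℓ e∈last = refl , s≤s i≤n , ≤-refl
  ...   | inj₂ e∈rest with ∈-++⁻ (edgesTo i (middle i)) e∈rest
  ...     | inj₂ e∈next rewrite ∈-replicate⁻ (m ∸ 1) e∈next = refl , ≤-refl , s≤s i≤n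
  ...     | inj₁ e∈middle with ∈-edgesTo⁻ i (middle i) e∈middle
  ...       | j , j∈ , refl with ∈-range⁻ (i + 2) (n ∸ (i + 1)) (Any.reverse⁻ j∈)
  ...         | 2+i≤j , j< = refl , <-≤-trans (m<m+n i (s≤s z≤n)) 2+i≤j ,
                             <⇒≤ (subst (j <_) (2+i+gap (≤∧≢⇒< i≤n i≢n)) j<)

  length-rowLabels : ∀ {i} → i ≤ n → length (rowLabels ℓ m n i) ≡ (ℓ ∸ 1) + m * (n ∸ i)
  length-rowLabels {i} i≤n with i ≟ n
  ... | yes refl = begin
    length (rowLabels ℓ m n n)     ≡⟨ cong length rowLabels-last ⟩
    length (replicate (ℓ ∸ 1) _)  ≡⟨ length-replicate (ℓ ∸ 1) ⟩
    ℓ ∸ 1                          ≡⟨ +-identityʳ (ℓ ∸ 1) ⟨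
    (ℓ ∸ 1) + 0                    ≡⟨ cong ((ℓ ∸ 1) +_) (trans (cong (m *_) (n∸n≡0 n)) (*-zeroʳ m)) ⟨
    (ℓ ∸ 1) + m * (n ∸ n)          ∎
    where open ≡-Reasoning
  ... | no i≢n = begin
    length (rowLabels ℓ m n i)
      ≡⟨ cong length (rowLabels-≢ i≢n) ⟩
    length (replicate ℓ (i , suc n) ++ edgesTo i (middle i) ++ replicate (m ∸ 1) (i , suc i))
      ≡⟨ length-++ (replicate ℓ _) ⟩
    length (replicate ℓ (i , suc n)) + length (edgesTo i (middle i) ++ replicate (m ∸ 1) (i , suc i))
      ≡⟨ cong₂ _+_ (length-replicate ℓ)
                   (trans (length-++ (edgesTo i (middle i))) (cong₂ _+_ length-middle (length-replicate (m ∸ 1)))) ⟩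
    ℓ + (m * c + (m ∸ 1))
      ≡⟨ arithmetic ℓ≥1 m≥1 ⟩
    (ℓ ∸ 1) + m * suc c
      ≡⟨ cong (λ t → (ℓ ∸ 1) + m * t) (∸≡suc∸suc (≤∧≢⇒< i≤n i≢n)) ⟨
    (ℓ ∸ 1) + m * (n ∸ i) ∎
    where
      open ≡-Reasoning
      c : ℕ
      c = n ∸ suc i
      length-middle : length (edgesTo i (middle i)) ≡ m * c
      length-middle = trans (length-edgesTo i (middle i))
                            (cong (m *_) (trans (length-reverse (range (i + 2) (n ∸ (i + 1))))
                                                (trans (length-range (i + 2) (n ∸ (i + 1))) (cong (n ∸_) (+-comm i 1)))))
      ∸≡suc∸suc : ∀ {i n} → i < n → n ∸ i ≡ suc (n ∸ suc i)
      ∸≡suc∸suc {zero}  {suc n} _         = refl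
      ∸≡suc∸suc {suc i} {suc n} (s≤s i<n) = ∸≡suc∸suc i<n
      arithmetic : ∀ {a b} → 1 ≤ a → 1 ≤ b → a + (b * c + (b ∸ 1)) ≡ (a ∸ 1) + b * suc c
      arithmetic {suc a} {suc b} _ _ = semiring a b c
        where
          semiring : ∀ a b c → suc a + (suc b * c + b) ≡ a + suc b * suc c
          semiring = solve-∀

  rowLabels-split : ∀ {i j} → i < j → j ≤ n →
                    ∃[ P ] ∃[ Q ] rowLabels ℓ m n i ≡ P ++ Q × length P ≡ ℓ + m * (n ∸ j) ×
                                  (∀ {e} → e ∈ P → j < proj₂ e)
  rowLabels-split {i} {j} i<j j≤n = P , Q , row≡ , length-P , P-long
    where
      e d : ℕ
      e = j ∸ (i + 1)
      d = n ∸ j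
      X Y P Q : List (ℕ × ℕ)
      X = replicate ℓ (i , suc n)
      Y = replicate (m ∸ 1) (i , suc i)
      P = X ++ edgesTo i (reverse (range (suc j) d))
      Q = edgesTo i (reverse (range (i + 2) e)) ++ Y
      i+1≤j : i + 1 ≤ j
      i+1≤j = subst (_≤ j) (+-comm 1 i) i<j
      gap : n ∸ (i + 1) ≡ e + d
      gap = trans (cong (_∸ (i + 1)) (sym (trans (sym (+-assoc (i + 1) e d))
                                                  (trans (cong (_+ d) (m+[n∸m]≡n i+1≤j)) (m+[n∸m]≡n j≤n)))))
                  (m+n∸m≡n (i + 1) (e + d))
      middle≡ : middle i ≡ reverse (range (suc j) d) ++ reverse (range (i + 2) e)
      middle≡ = begin
        reverse (range (i + 2) (n ∸ (i + 1)))                 ≡⟨ cong (reverse ∘ range (i + 2)) gap ⟩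
        reverse (range (i + 2) (e + d))                       ≡⟨ cong reverse (range-++ (i + 2) e d) ⟩
        reverse (range (i + 2) e ++ range (i + 2 + e) d)       ≡⟨ reverse-++ (range (i + 2) e) _ ⟩
        reverse (range (i + 2 + e) d) ++ reverse (range (i + 2) e)
          ≡⟨ cong (λ b → reverse (range b d) ++ reverse (range (i + 2) e))
                  (trans (cong (_+ e) (+-suc i 1)) (cong suc (m+[n∸m]≡n i+1≤j))) ⟩
        reverse (range (suc j) d) ++ reverse (range (i + 2) e) ∎
        where open ≡-Reasoning
      row≡ : rowLabels ℓ m n i ≡ P ++ Q
      row≡ = begin
        rowLabels ℓ m n i
          ≡⟨ rowLabels-≢ (λ i≡n → <⇒≱ i<j (subst (j ≤_) (sym i≡n) j≤n)) ⟩
        X ++ edgesTo i (middle i) ++ Y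
          ≡⟨ cong (λ js → X ++ js ++ Y) (trans (cong (edgesTo i) middle≡) (concatMap-++ _ (reverse (range (suc j) d)) _)) ⟩
        X ++ (edgesTo i (reverse (range (suc j) d)) ++ edgesTo i (reverse (range (i + 2) e))) ++ Y
          ≡⟨ cong (X ++_) (++-assoc (edgesTo i (reverse (range (suc j) d))) _ Y) ⟩
        X ++ (edgesTo i (reverse (range (suc j) d)) ++ Q)
          ≡⟨ ++-assoc X _ Q ⟨
        P ++ Q ∎
        where open ≡-Reasoning
      length-P : length P ≡ ℓ + m * d
      length-P = trans (length-++ X) (cong₂ _+_ (length-replicate ℓ)
                   (trans (length-edgesTo i (reverse (range (suc j) d)))
                          (cong (m *_) (trans (length-reverse (range (suc j) d)) (length-range (suc j) d)))))
      P-long : ∀ {x} → x ∈ P → j < proj₂ x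
      P-long x∈ with ∈-++⁻ X x∈
      ... | inj₁ x∈X rewrite ∈-replicate⁻ ℓ x∈X = s≤s j≤n
      ... | inj₂ x∈edges with ∈-edgesTo⁻ i _ x∈edges
      ...   | t , t∈ , refl = proj₁ (∈-range⁻ (suc j) d (Any.reverse⁻ t∈))

  count-long-rowPrefix : ∀ {i e j} t → i ≤ n → e ∈ take t (rowLabels ℓ m n i) → proj₂ e ≤ j → j ≤ n →
                         ℓ + m * (n ∸ j) ≤ count (λ e′ → j <ᵇ proj₂ e′) (take t (rowLabels ℓ m n i))
  count-long-rowPrefix {i} {e} {j} t i≤n e∈ r≤j j≤n
    with rowLabels-split (<-≤-trans (proj₁ (proj₂ (rowLabels-edge i≤n (∈-take⁻ t _ e∈)))) r≤j) j≤n
  ... | P , Q , row≡ , length-P , P-long rewrite row≡ =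
    subst (_≤ count (λ e′ → j <ᵇ proj₂ e′) (take t (P ++ Q))) length-P
          (count-take-++ _ P Q t (<ᵇ-true ∘ P-long) e∈ (<ᵇ-false r≤j))

  open Staircase ℓ m

  topRows : ℕ → List ℕ → List (ℕ × ℕ)
  topRows s []       = []
  topRows s (x ∷ xs) = take x (rowLabels ℓ m n s) ++ topRows (suc s) xs

  concat-zipWith-topRows : ∀ s xs →
    concat (zipWith (λ i μi → take μi (rowLabels ℓ m n i)) (range s (length xs)) xs) ≡ topRows s xs
  concat-zipWith-topRows s []       = refl
  concat-zipWith-topRows s (x ∷ xs) = cong (take x (rowLabels ℓ m n s) ++_) (concat-zipWith-topRows (suc s) xs)

  rows-left : ∀ {s l} → s + suc l ≡ suc n → s ≤ n × suc s + l ≡ suc n × n ∸ s ≡ l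
  rows-left {s} {l} s+1+l≡1+n = subst (s ≤_) s+l≡n (m≤m+n s l) , trans (sym (+-suc s l)) s+1+l≡1+n ,
                                trans (cong (_∸ s) (sym s+l≡n)) (m+n∸m≡n s l)
    where
      s+l≡n : s + l ≡ n
      s+l≡n = suc-injective (trans (sym (+-suc s l)) s+1+l≡1+n)

  topRows-edge : ∀ s xs → s + length xs ≡ suc n → ∀ {e} → e ∈ topRows s xs →
                 s ≤ proj₁ e × proj₁ e ≤ n × proj₁ e < proj₂ e × proj₂ e ≤ suc n
  topRows-edge s (x ∷ xs) rows {e} e∈ with rows-left rows
  ... | s≤n , rows′ , _ with ∈-++⁻ (take x (rowLabels ℓ m n s)) e∈
  ...   | inj₁ e∈row with rowLabels-edge s≤n (∈-take⁻ x _ e∈row)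
  ...     | refl , s<r , r≤1+n = ≤-refl , s≤n , s<r , r≤1+n
  topRows-edge s (x ∷ xs) rows e∈ | s≤n , rows′ , _ | inj₂ e∈rest with topRows-edge (suc s) xs rows′ e∈rest
  ...     | s<i , bounds = <⇒≤ s<i , bounds

  outDegree-topRows : ∀ s xs → SubStaircase 0 xs → s + length xs ≡ suc n →
                      map (outDegree (topRows s xs)) (range s (length xs)) ≡ xs
  outDegree-topRows s []       _                  _    = refl
  outDegree-topRows s (x ∷ xs) (x≤ , _ , stair) rows with rows-left rows
  ... | s≤n , rows′ , n∸s≡l = cong₂ _∷_ head≡ tail≡
    where
      row rest : List (ℕ × ℕ)
      row  = take x (rowLabels ℓ m n s)
      rest = topRows (suc s) xs
      row-source : ∀ {e} → e ∈ row → proj₁ e ≡ s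
      row-source e∈ = proj₁ (rowLabels-edge s≤n (∈-take⁻ x _ e∈))
      rest-source : ∀ {e} → e ∈ rest → s < proj₁ e
      rest-source e∈ = proj₁ (topRows-edge (suc s) xs rows′ e∈)
      x≤length : x ≤ length (rowLabels ℓ m n s)
      x≤length = subst (x ≤_) (sym (trans (length-rowLabels s≤n)
                                          (cong (λ t → (ℓ ∸ 1) + m * t) (trans n∸s≡l (sym (+-identityʳ _)))))) x≤
      head≡ : outDegree (row ++ rest) s ≡ x
      head≡ = begin
        outDegree (row ++ rest) s                          ≡⟨ count-++ _ row rest ⟩
        count (λ e → s ≡ᵇ proj₁ e) row + outDegree rest s
          ≡⟨ cong₂ _+_ (count-all _ (λ e∈ → ≡ᵇ-≡ (sym (row-source e∈))))
                       (count-none _ (λ e∈ → ≡ᵇ-≢ (<⇒≢ (rest-source e∈)))) ⟩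
        length row + 0                                     ≡⟨ +-identityʳ _ ⟩
        length row                                         ≡⟨ length-take x _ ⟩
        x ⊓ length (rowLabels ℓ m n s)                     ≡⟨ m≤n⇒m⊓n≡m x≤length ⟩
        x                                                  ∎
        where open ≡-Reasoning
      outDegree-rest : ∀ {k} → k ∈ range (suc s) (length xs) → outDegree (row ++ rest) k ≡ outDegree rest k
      outDegree-rest k∈ = trans (count-++ _ row rest)
        (cong (_+ _) (count-none _ (λ e∈ → ≡ᵇ-≢ (>⇒≢ (subst (_< _) (sym (row-source e∈))
                                                           (proj₁ (∈-range⁻ (suc s) _ k∈)))))))
      tail≡ : map (outDegree (row ++ rest)) (range (suc s) (length xs)) ≡ xs
      tail≡ = trans (map-cong-local (All.tabulate outDegree-rest)) (outDegree-topRows (suc s) xs stair rows′)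

  long-edges-topRows : ∀ s xs → s + length xs ≡ suc n →
                       ∀ {e} → e ∈ topRows s xs → ∀ {j} → proj₂ e ≤ j → j ≤ n →
                       ℓ + m * (n ∸ j) ≤ count (longerThan (proj₁ e) j) (topRows s xs)
  long-edges-topRows s (x ∷ xs) rows {e} e∈ {j} r≤j j≤n with rows-left rows
  ... | s≤n , rows′ , _ with ∈-++⁻ (take x (rowLabels ℓ m n s)) e∈
  ...   | inj₂ e∈rest = begin
    ℓ + m * (n ∸ j)                                        ≤⟨ long-edges-topRows (suc s) xs rows′ e∈rest r≤j j≤n ⟩
    count (longerThan (proj₁ e) j) (topRows (suc s) xs)    ≤⟨ m≤n+m _ _ ⟩
    count (longerThan (proj₁ e) j) (take x (rowLabels ℓ m n s)) + count (longerThan (proj₁ e) j) (topRows (suc s) xs)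
                                                           ≡⟨ count-++ _ (take x (rowLabels ℓ m n s)) _ ⟨
    count (longerThan (proj₁ e) j) (topRows s (x ∷ xs))    ∎
    where open ≤-Reasoning
  ...   | inj₁ e∈row = begin
    ℓ + m * (n ∸ j)                                        ≤⟨ count-long-rowPrefix x s≤n e∈row r≤j j≤n ⟩
    count (λ e′ → j <ᵇ proj₂ e′) row                       ≡⟨ sum-map-cong _ _ same-source ⟩
    count (longerThan (proj₁ e) j) row                     ≤⟨ m≤m+n _ _ ⟩
    count (longerThan (proj₁ e) j) row + count (longerThan (proj₁ e) j) (topRows (suc s) xs)
                                                           ≡⟨ count-++ _ row _ ⟨
    count (longerThan (proj₁ e) j) (topRows s (x ∷ xs))    ∎
    where
      open ≤-Reasoning
      row : List (ℕ × ℕ)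
      row = take x (rowLabels ℓ m n s)
      row-source : ∀ {e′} → e′ ∈ row → proj₁ e′ ≡ s
      row-source e′∈ = proj₁ (rowLabels-edge s≤n (∈-take⁻ x _ e′∈))
      same-source : ∀ {e′} → e′ ∈ row → indicator (j <ᵇ proj₂ e′) ≡ indicator (longerThan (proj₁ e) j e′)
      same-source e′∈ rewrite ≡ᵇ-≡ (trans (row-source e∈row) (sym (row-source e′∈))) = refl

  module _ (f : ℕ → ℕ) where

    values-subStaircase : ∀ s xs → SubStaircase 0 xs → map f (range s (length xs)) ≡ xs → s + length xs ≡ suc n →
                          ∀ {j} → s ≤ j → j ≤ n → f j ≤ (ℓ ∸ 1) + m * (n ∸ j)
    values-subStaircase s [] _ _ rows s≤j j≤n =
      ⊥-elim (<-irrefl refl (≤-trans (subst (_≤ _) (trans (sym (+-identityʳ s)) rows) s≤j) j≤n))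
    values-subStaircase s (x ∷ xs) (x≤ , _ , stair) f≡ rows {j} s≤j j≤n with rows-left rows | ∷-injective f≡
    ... | _ , rows′ , n∸s≡l | fs≡x , f≡′ with s ≟ j
    ...   | yes refl = subst₂ _≤_ (sym fs≡x) (cong (λ t → (ℓ ∸ 1) + m * t) (trans (+-identityʳ _) (sym n∸s≡l))) x≤
    ...   | no s≢j   = values-subStaircase (suc s) xs stair f≡′ rows′ (≤∧≢⇒< s≤j s≢j) j≤n

    values-antitone : ∀ s xs → SubStaircase 0 xs → map f (range s (length xs)) ≡ xs → s + length xs ≡ suc n →
                      ∀ {k j} → s ≤ k → k ≤ j → j ≤ n → f j ≤ f k
    values-antitone s [] _ _ rows s≤k k≤j j≤n =
      ⊥-elim (<-irrefl refl (≤-trans (subst (_≤ _) (trans (sym (+-identityʳ s)) rows) (≤-trans s≤k k≤j)) j≤n))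
    values-antitone s (x ∷ xs) (_ , below , stair) f≡ rows {k} {j} s≤k k≤j j≤n with rows-left rows | ∷-injective f≡
    ... | _ , rows′ , _ | fs≡x , f≡′ with s ≟ k
    ...   | no s≢k   = values-antitone (suc s) xs stair f≡′ rows′ (≤∧≢⇒< s≤k s≢k) k≤j j≤n
    ...   | yes refl with s ≟ j
    ...     | yes refl = ≤-refl
    ...     | no s≢j   = subst (f j ≤_) (sym fs≡x) (All.lookup below (subst (f j ∈_) f≡′ (∈-map⁺ f j∈)))
      where
        j∈ : j ∈ range (suc s) (length xs)
        j∈ = ∈-range⁺ (suc s) (length xs) (≤∧≢⇒< k≤j s≢j) (subst (j <_) (sym rows′) (s≤s j≤n))

  subStaircaseᵇ-true : ∀ s xs → SubStaircase 0 xs → s + length xs ≡ suc n →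
                       foldr _∧_ true (zipWith (λ i λi → λi ≤ᵇ (ℓ ∸ 1) + m * (n ∸ i)) (range s (length xs)) xs) ≡ true
  subStaircaseᵇ-true s []       _                  _    = refl
  subStaircaseᵇ-true s (x ∷ xs) (x≤ , _ , stair) rows with rows-left rows
  ... | _ , rows′ , n∸s≡l
    rewrite ≤ᵇ-true (subst (λ t → x ≤ (ℓ ∸ 1) + m * t) (trans (+-identityʳ _) (sym n∸s≡l)) x≤) =
    subStaircaseᵇ-true (suc s) xs stair rows′

  module OfPath (D : List Step) (dyck : IsDyck ℓ m n D) where

    μ : List ℕ
    μ = areaPartition D

    private
      northXs-line : LeftOfLineFrom 0 (northXs 0 D) × All (0 ≤_) (northXs 0 D) × length (northXs 0 D) + 0 ≡ n
      northXs-line = northXs-leftOfLine 0 0 D dyck z≤n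

    length-μ : length μ ≡ n
    length-μ = trans (length-reverse (northXs 0 D)) (trans (sym (+-identityʳ _)) (proj₂ (proj₂ northXs-line)))

    rows : 1 + length μ ≡ suc n
    rows = cong suc length-μ

    μ-subStaircase : SubStaircase 0 μ
    μ-subStaircase = reverse-subStaircase 0 (northXs 0 D) (proj₁ northXs-line)

    northXs-ascending : Linked _≤_ (northXs 0 D)
    northXs-ascending = leftOfLine-ascending 0 (northXs 0 D) (proj₁ northXs-line)

    reverse-μ-ascending : Linked _≤_ (reverse μ)
    reverse-μ-ascending = subst (Linked _≤_) (sym (reverse-involutive (northXs 0 D))) northXs-ascending

    rowIndices : map suc (upTo n) ≡ range 1 (length μ)
    rowIndices = trans (map-+-upTo 1 n) (cong (range 1) (sym length-μ))

    G≡ : G ℓ m n D ≡ topRows 1 μ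
    G≡ = trans (cong (λ is → concat (zipWith (λ i μi → take μi (rowLabels ℓ m n i)) is μ)) rowIndices)
               (concat-zipWith-topRows 1 μ)

    edge-bounds : ∀ {e} → e ∈ G ℓ m n D → 1 ≤ proj₁ e × proj₁ e ≤ n × proj₁ e < proj₂ e × proj₂ e ≤ suc n
    edge-bounds e∈ = topRows-edge 1 μ rows (subst (_ ∈_) G≡ e∈)

    private
      outDegrees-μ : map (outDegree (G ℓ m n D)) (range 1 (length μ)) ≡ μ
      outDegrees-μ = subst (λ H → map (outDegree H) (range 1 (length μ)) ≡ μ) (sym G≡)
                           (outDegree-topRows 1 μ μ-subStaircase rows)

    outDegrees≡μ : map (outDegree (G ℓ m n D)) (range 1 n) ≡ μ
    outDegrees≡μ = subst (λ t → map (outDegree (G ℓ m n D)) (range 1 t) ≡ μ) length-μ outDegrees-μ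

    outDegree-staircase : ∀ {j} → 1 ≤ j → j ≤ n → outDegree (G ℓ m n D) j ≤ (ℓ ∸ 1) + m * (n ∸ j)
    outDegree-staircase = values-subStaircase (outDegree (G ℓ m n D)) 1 μ μ-subStaircase outDegrees-μ rows

    outDegree-antitone : ∀ {k j} → 1 ≤ k → k ≤ j → j ≤ n → outDegree (G ℓ m n D) j ≤ outDegree (G ℓ m n D) k
    outDegree-antitone = values-antitone (outDegree (G ℓ m n D)) 1 μ μ-subStaircase outDegrees-μ rows

    long-edges : ∀ {e} → e ∈ G ℓ m n D → ∀ {j} → proj₂ e ≤ j → j ≤ n →
                 ℓ + m * (n ∸ j) ≤ count (longerThan (proj₁ e) j) (G ℓ m n D)
    long-edges {e} e∈ {j} r≤j j≤n = subst (λ H → ℓ + m * (n ∸ j) ≤ count (longerThan (proj₁ e) j) H) (sym G≡)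
                                          (long-edges-topRows 1 μ rows (subst (_ ∈_) G≡ e∈) r≤j j≤n)

    μ-subStaircaseᵇ : subStaircaseᵇ ℓ m n μ ≡ true
    μ-subStaircaseᵇ = subst (λ is → foldr _∧_ true (zipWith (λ i λi → λi ≤ᵇ (ℓ ∸ 1) + m * (n ∸ i)) is μ) ≡ true)
                            (sym rowIndices) (subStaircaseᵇ-true 1 μ μ-subStaircase rows)

-- The leading term

module _ {n : ℕ} where
  open Expansion (suc n)

  toList-exponent-∷ʳ : ∀ ps →
    toList (exponent ps) ≡ map (fibreSize pickedVar ps) (range 1 n) ∷ʳ fibreSize pickedVar ps (suc n)
  toList-exponent-∷ʳ ps = trans (toList-exponent ps)
                                (trans (cong (map (fibreSize pickedVar ps)) (sym (range-∷ʳ 1 n)))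
                                       (map-++ (fibreSize pickedVar ps) (range 1 n) _))

  exponent≡∷ʳ0⁻ : ∀ ps (α : Vec ℕ n) → exponent ps ≡ α Vec.∷ʳ 0 →
                  toList α ≡ map (fibreSize pickedVar ps) (range 1 n) × fibreSize pickedVar ps (suc n) ≡ 0
  exponent≡∷ʳ0⁻ ps α exponent≡ =
    map₁ sym (∷ʳ-injective _ (toList α)
      (trans (sym (toList-exponent-∷ʳ ps)) (trans (cong toList exponent≡) (Vec.toList-∷ʳ 0 α))))

  exponent≡∷ʳ0⁺ : ∀ ps (α : Vec ℕ n) → toList α ≡ map (fibreSize pickedVar ps) (range 1 n) →
                  fibreSize pickedVar ps (suc n) ≡ 0 → exponent ps ≡ α Vec.∷ʳ 0
  exponent≡∷ʳ0⁺ ps α α≡ last≡0 = trans (sym (Vec.cast-is-id refl (exponent ps))) (Vec.toList-injective refl _ _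
    (trans (toList-exponent-∷ʳ ps) (trans (cong₂ _∷ʳ_ (sym α≡) last≡0) (sym (Vec.toList-∷ʳ 0 α)))))

φ-subStaircase : ∀ ℓ m {n} c (α : Vec ℕ n) → subStaircaseMonᵇ ℓ m n α ≡ true → φ ℓ m n c α ≡ c (α Vec.∷ʳ 0)
φ-subStaircase ℓ m {n} c α sub rewrite sub = refl

φ-≢0 : ∀ ℓ m {n} c (α : Vec ℕ n) → φ ℓ m n c α ≢ 0ℤ → c (α Vec.∷ʳ 0) ≢ 0ℤ
φ-≢0 ℓ m {n} c α φ≢0 with subStaircaseMonᵇ ℓ m n α
... | true  = φ≢0
... | false = ⊥-elim (φ≢0 refl)

module LeadingTerm (ℓ m n : ℕ) (ℓ≥1 : 1 ≤ ℓ) (m≥1 : 1 ≤ m) (D : List Step) (dyck : IsDyck ℓ m n D) where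
  open Rows ℓ m n ℓ≥1 m≥1
  open OfPath D dyck public
  open Expansion (suc n)
  open Domination ℓ m n ℓ≥1 (G ℓ m n D) edge-bounds outDegree-antitone outDegree-staircase long-edges

  private
    G′ : List (ℕ × ℕ)
    G′ = G ℓ m n D
    others : List (List Pick)
    others = proj₁ (picks-leftPicks G′)

  pD≡ : pD ℓ m n D ≡ monomial (leftPicks G′) ∷ map monomial others
  pD≡ = trans (∏-diffPoly-picks G′) (cong (map monomial) (proj₁ (proj₂ (picks-leftPicks G′))))

  α₀ : Vec ℕ n
  α₀ = Vec.tabulate (λ r → outDegree G′ (suc (toℕ r)))

  toList-α₀ : toList α₀ ≡ μ
  toList-α₀ = trans (toList-lookup α₀ 1 (outDegree G′) (Vec.lookup∘tabulate _)) outDegrees≡μ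

  expPartition-α₀ : expPartition α₀ ≡ μ
  expPartition-α₀ = begin
    reverse (sort (toList α₀))  ≡⟨ cong (reverse ∘ sort) toList-α₀ ⟩
    reverse (sort μ)            ≡⟨ cong reverse (sort-↭-ascending (↭.↭-reverse (northXs 0 D)) northXs-ascending) ⟩
    μ                           ∎
    where open ≡-Reasoning

  exponent-leftPicks : exponent (leftPicks G′) ≡ α₀ Vec.∷ʳ 0
  exponent-leftPicks = exponent≡∷ʳ0⁺ (leftPicks G′) α₀
    (trans (toList-lookup α₀ 1 (outDegree G′) (Vec.lookup∘tabulate _))
           (map-cong-local (All.tabulate (λ _ → sym (count-map _ (_, false) G′)))))
    (trans (count-map _ (_, false) G′)
           (count-none _ (λ e∈ → ≡ᵇ-≢ (>⇒≢ (s≤s (proj₁ (proj₂ (edge-bounds e∈))))))))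

  other-dominated : ∀ {ps} → ps ∈ others → (α : Vec ℕ n) → exponent ps ≡ α Vec.∷ʳ 0 →
                    toList α ◁ μ × sum (toList α) ≡ sum μ
  other-dominated {ps} ps∈ α exponent≡ with exponent≡∷ʳ0⁻ ps α exponent≡
  ... | α≡ , last≡0 =
    subst₂ _◁_ (sym α≡) outDegrees≡μ (exponents-◁-outDegrees ps ps-edges ps-pickedʳ last≡0) ,
    subst₂ (λ xs ys → sum xs ≡ sum ys) (sym α≡) outDegrees≡μ
           (sum-exponents≡sum-outDegrees ps ps-edges ps-pickedʳ last≡0)
    where
      ps-edges : map proj₁ ps ≡ G′
      ps-edges = picks-edges G′ (subst (ps ∈_) (sym (proj₁ (proj₂ (picks-leftPicks G′)))) (there ps∈))
      ps-pickedʳ : Pickedʳ ps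
      ps-pickedʳ = proj₂ (proj₂ (picks-leftPicks G′)) ps∈

  coeff-α₀ : coeff (pD ℓ m n D) (α₀ Vec.∷ʳ 0) ≡ 1ℤ
  coeff-α₀ = begin
    coeff (pD ℓ m n D) (α₀ Vec.∷ʳ 0)
      ≡⟨ cong (λ P → coeff P (α₀ Vec.∷ʳ 0)) pD≡ ⟩
    coeff (monomial (leftPicks G′) ∷ map monomial others) (α₀ Vec.∷ʳ 0)
      ≡⟨ coeff-∷-≡ _ (map monomial others) exponent-leftPicks ⟩
    sign (leftPicks G′) ℤ.+ coeff (map monomial others) (α₀ Vec.∷ʳ 0)
      ≡⟨ cong₂ ℤ._+_ (sign-leftPicks G′) (coeff-absent (map monomial others) not-α₀) ⟩
    1ℤ ∎
    where
      open ≡-Reasoning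
      not-α₀ : ∀ {t} → t ∈ map monomial others → proj₂ t ≢ α₀ Vec.∷ʳ 0
      not-α₀ t∈ exponent≡ with ∈-map⁻ monomial t∈
      ... | ps , ps∈ , refl = ◁-irrefl {μ} (subst (_◁ μ) toList-α₀ (proj₁ (other-dominated ps∈ α₀ exponent≡)))

  coeff-≢0-dominated : (α : Vec ℕ n) → toList α ≢ μ → coeff (pD ℓ m n D) (α Vec.∷ʳ 0) ≢ 0ℤ →
                       toList α ◁ μ × sum (toList α) ≡ sum μ
  coeff-≢0-dominated α α≢μ coeff≢0 with coeff-≢0 _ (subst (λ P → coeff P (α Vec.∷ʳ 0) ≢ 0ℤ) pD≡ coeff≢0)
  ... | t , here refl , exponent≡ =
    ⊥-elim (α≢μ (trans (cong toList (Vec.∷ʳ-injectiveˡ α α₀ (trans (sym exponent≡) exponent-leftPicks)))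
                       toList-α₀))
  ... | t , there t∈ , exponent≡ with ∈-map⁻ monomial t∈
  ...   | ps , ps∈ , refl = other-dominated ps∈ α exponent≡

  φ-α₀ : φ ℓ m n (coeff (pD ℓ m n D)) α₀ ≡ 1ℤ
  φ-α₀ = trans (φ-subStaircase ℓ m (coeff (pD ℓ m n D)) α₀ α₀-subStaircase) coeff-α₀
    where
      α₀-subStaircase : subStaircaseMonᵇ ℓ m n α₀ ≡ true
      α₀-subStaircase = trans (cong (subStaircaseᵇ ℓ m n) expPartition-α₀) μ-subStaircaseᵇ

  φ-≢0⇒≺ : (α : Vec ℕ n) → toList α ≢ μ → φ ℓ m n (coeff (pD ℓ m n D)) α ≢ 0ℤ → expPartition α ≺ μ
  φ-≢0⇒≺ α α≢μ φ≢0 with coeff-≢0-dominated α α≢μ (φ-≢0 ℓ m (coeff (pD ℓ m n D)) α φ≢0)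
  ... | α◁μ , sum≡ =
    ◁⇒≺ (toList α) μ reverse-μ-ascending (trans (Vec.length-toList α) (sym length-μ)) sum≡ α◁μ

lemma5 : (ℓ m n : ℕ) → 1 ≤ ℓ → 1 ≤ m → 1 ≤ n →
         (D : List Step) → IsDyck ℓ m n D →
         Σ (Vec ℕ n) (λ α → (toList α ≡ areaPartition D)
                            × (φ ℓ m n (coeff (pD ℓ m n D)) α ≡ 1ℤ))
         × ((α : Vec ℕ n) → toList α ≢ areaPartition D →
            φ ℓ m n (coeff (pD ℓ m n D)) α ≢ 0ℤ →
            expPartition α ≺ areaPartition D)
lemma5 ℓ m n ℓ≥1 m≥1 _ D dyck = (α₀ , toList-α₀ , φ-α₀) , φ-≢0⇒≺
  where open LeadingTerm ℓ m n ℓ≥1 m≥1 D dyck
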